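{- Let $a$ be a positive integer and $L_{a,a}=\{C_{i,1}:1\le i\le a+1\}\cup\{C_{1,j}:1<j\le a+1\}$, an $L$-shaped polyomino of size $2a+1$. Then on the $(2a+1)\times(2a+1)$ board, $\mathrm{cp}_{\mathrm{free}}(L_{a,a})=2$.
   Context: A cell $C_{i,j}$ ($i,j$ integers) is the closed unit square in column $i$ and row $j$ of the integer grid. A polyomino is a finite set of cells; its size is its number of cells. For a polyomino $\mathcal P$ of size $n$, the board is $\mathbb B=\{C_{i,j}:1\le i,j\le n\}$. A shift of $\mathcal P$ by an integer pair $(c,d)$ is $\{C_{x+c,y+d}:C_{x,y}\in\mathcal P\}$. Two polyominoes are free equivalent if one is obtained from the other by a rotation of the grid by an integer multiple of $90^\circ$ followed by a shift (reflections are not allowed). A set of polyominoes is a valid arrangement if all lie in $\mathbb B$ and they are pairwise disjoint. A free packing of $\mathcal P$ is a valid arrangement of polyominoes free equivalent to $\mathcal P$ such that adding any further polyomino free equivalent to $\mathcal P$ yields an invalid arrangement. The clumsy free packing number $\mathrm{cp}_{\mathrm{free}}(\mathcal P)$ is the minimum number of polyominoes in a free packing of $\mathcal P$ on the $n\times n$ board, $n=|\mathcal P|$. -}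

module Defs where

open import Data.Nat as ℕ using (ℕ; zero; suc)
open import Data.Integer as ℤ using (ℤ; +_; -_; _+_; _≤_)
open import Data.Product using (_×_; _,_; ∃; Σ)
open import Data.List using (List; []; _∷_; map; _++_; upTo; length)
open import Data.List.Membership.Propositional using (_∈_)
open import Data.List.Relation.Unary.All using (All)
open import Data.List.Relation.Unary.AllPairs using (AllPairs)
open import Data.Fin using (Fin; toℕ)
open import Data.Empty using (⊥)
open import Relation.Nullary using (¬_)
open import Relation.Binary.PropositionalEquality using (_≡_)

Cell : Set
Cell = ℤ × ℤ

Polyomino : Set
Polyomino = List Cell

rot90 : Cell → Cell
rot90 (x , y) = (- y , x)

rotN : ℕ → Cell → Cell
rotN zero    c = c
rotN (suc k) c = rot90 (rotN k c)

record Placement : Set where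
  constructor place
  field
    r  : Fin 4
    dx : ℤ
    dy : ℤ

shiftCell : ℤ → ℤ → Cell → Cell
shiftCell c d (x , y) = (x + c , y + d)

image : Polyomino → Placement → Polyomino
image P (place r c d) = map (λ z → shiftCell c d (rotN (toℕ r) z)) P

InBoardCell : ℕ → Cell → Set
InBoardCell n (i , j) = (+ 1 ≤ i × i ≤ + n) × (+ 1 ≤ j × j ≤ + n)

InBoard : ℕ → Polyomino → Set
InBoard n Q = All (InBoardCell n) Q

Disjoint : Polyomino → Polyomino → Set
Disjoint Q R = ∀ x → x ∈ Q → x ∈ R → ⊥

Valid : ℕ → Polyomino → List Placement → Set
Valid n P ps = All (λ p → InBoard n (image P p)) ps
             × AllPairs (λ p q → Disjoint (image P p) (image P q)) ps

FreePacking : ℕ → Polyomino → List Placement → Set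
FreePacking n P ps = Valid n P ps × (∀ q → ¬ Valid n P (q ∷ ps))

CpFreeIs : ℕ → Polyomino → ℕ → Set
CpFreeIs n P k =
  (Σ (List Placement) λ ps → FreePacking n P ps × length ps ≡ k)
  × (∀ ps → FreePacking n P ps → k ℕ.≤ length ps)

Laa : ℕ → Polyomino
Laa a = map (λ i → (+ suc i , + 1)) (upTo (suc a))
     ++ map (λ j → (+ 1 , + (2 ℕ.+ j))) (upTo a)

-- Every copy of L_{a,a} inside the board is an L whose two arms of a + 1 cells
-- meet in a corner cell. The copies L₁, with corner (1, a) and arms to the right and
-- upwards, and L₂, with corner (a + 1, a + 1) and arms likewise, form a maximal
-- packing: a copy whose vertical arm lies right of column a crosses row a + 1 inside
-- L₂; otherwise, if its vertical arm reaches down to row a it meets L₁ there, and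
-- if not, its horizontal arm lies above row a and crosses column a + 1 inside L₂.
-- A single copy is never maximal: its arms are shorter than the board, so it misses
-- the first or last row and the first or last column, and the copy in that corner of
-- the board, which occupies only this row and column, can be added.

module Submission where

open import Data.Empty using (⊥; ⊥-elim)
open import Data.Fin using (toℕ)
open import Data.Fin.Patterns using (0F; 1F; 2F; 3F)
open import Data.Integer as ℤ using (+_; -[1+_]; _⊖_; +≤+)
import Data.Integer.Properties as ℤ
open import Data.List using ([]; _∷_; map; _++_; upTo; length)
open import Data.List.Membership.Propositional using (_∈_)
open import Data.List.Membership.Propositional.Properties
  using (∈-++⁺ˡ; ∈-++⁺ʳ; ∈-++⁻; ∈-map⁺; ∈-map⁻; ∈-upTo⁺; ∈-upTo⁻)
import Data.List.Relation.Unary.All as All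
open All using ([]; _∷_)
open import Data.List.Relation.Unary.AllPairs using ([]; _∷_)
open import Data.Nat using (ℕ; zero; suc; _≤_; _<_; _+_; _*_; _∸_; z≤n; s≤s; _≤?_)
open import Data.Nat.Properties
open import Data.Product using (Σ; _×_; _,_; proj₁; proj₂)
open import Data.Sum using (_⊎_; inj₁; inj₂)
open import Relation.Nullary using (¬_; yes; no)
open import Relation.Binary.PropositionalEquality using (_≡_; refl; sym; trans; cong; cong₂; subst)

open import Defs

Segment : ℕ → ℕ → ℕ → Set
Segment lo a x = lo ≤ x × x ≤ lo + a

Outside : ℕ → ℕ → ℕ → Set
Outside lo a x = x < lo ⊎ lo + a < x

outside⇒∉segment : ∀ {lo a x} → Outside lo a x → ¬ Segment lo a x
outside⇒∉segment (inj₁ x<lo) (lo≤x , _) = <⇒≱ x<lo lo≤x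
outside⇒∉segment (inj₂ hi<x) (_ , x≤hi) = <⇒≱ hi<x x≤hi

shifted∈segment : ∀ {a i} M → i ≤ a → Segment (suc M) a (suc (i + M))
shifted∈segment {a} {i} M i≤a =
  s≤s (m≤n+m M i) , s≤s (≤-trans (+-monoˡ-≤ M i≤a) (≤-reflexive (+-comm a M)))

segment⇒shifted : ∀ {a x} M → Segment (suc M) a x → Σ ℕ λ i → i ≤ a × suc (i + M) ≡ x
segment⇒shifted {a} {x} M (lo≤x , x≤hi) = x ∸ suc M ,
  ≤-trans (∸-monoˡ-≤ (suc M) x≤hi) (≤-reflexive (m+n∸m≡n (suc M) a)) ,
  trans (sym (+-suc (x ∸ suc M) M)) (m∸n+n≡m lo≤x)

reflected∈segment : ∀ {a i} P → i ≤ a → Segment P a (a + P ∸ i)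
reflected∈segment {a} {i} P i≤a =
  subst (P ≤_) (sym (+-∸-comm P i≤a)) (m≤n+m P (a ∸ i)) ,
  ≤-trans (m∸n≤m (a + P) i) (≤-reflexive (+-comm a P))

segment⇒reflected : ∀ {a x} P → Segment P a x → Σ ℕ λ i → i ≤ a × a + P ∸ i ≡ x
segment⇒reflected {a} {x} P (lo≤x , x≤hi) = a + P ∸ x ,
  ≤-trans (∸-monoʳ-≤ (a + P) lo≤x) (≤-reflexive (m+n∸n≡m a P)) ,
  m∸[m∸n]≡n (≤-trans x≤hi (≤-reflexive (+-comm P a)))

-[1+k]+[1+a+P]≡a+P∸k : ∀ a P {k} → k ≤ a → -[1+ k ] ℤ.+ + suc (a + P) ≡ + (a + P ∸ k)
-[1+k]+[1+a+P]≡a+P∸k a P k≤a = ℤ.⊖-≥ (s≤s (≤-trans k≤a (m≤m+n a P)))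

1≤m⊖n⇒n<m : ∀ m n → + 1 ℤ.≤ m ⊖ n → n < m
1≤m⊖n⇒n<m m       zero    1≤m = ℤ.drop‿+≤+ 1≤m
1≤m⊖n⇒n<m (suc m) (suc n) 1≤m⊖n =
  s≤s (1≤m⊖n⇒n<m m n (subst (+ 1 ℤ.≤_) (ℤ.[1+m]⊖[1+n]≡m⊖n m n) 1≤m⊖n))

1≤1+z⇒0≤z : ∀ z → + 1 ℤ.≤ + 1 ℤ.+ z → Σ ℕ λ M → z ≡ + M
1≤1+z⇒0≤z (+ M)    _   = M , refl
1≤1+z⇒0≤z -[1+ m ] 1≤z with 1≤m⊖n⇒n<m 1 (suc m) 1≤z
... | s≤s ()

1≤-[1+a]+z⇒a<z : ∀ a z → + 1 ℤ.≤ -[1+ a ] ℤ.+ z → Σ ℕ λ P → z ≡ + suc (a + P)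
1≤-[1+a]+z⇒a<z a (+ m) 1≤z =
  m ∸ suc a , cong +_ (sym (m+[n∸m]≡n (<⇒≤ (1≤m⊖n⇒n<m m (suc a) 1≤z))))

Laa-row : ∀ {a i} → i ≤ a → (+ suc i , + 1) ∈ Laa a
Laa-row i≤a = ∈-++⁺ˡ (∈-map⁺ (λ i → (+ suc i , + 1)) (∈-upTo⁺ (s≤s i≤a)))

Laa-column : ∀ {a k} → k ≤ a → (+ 1 , + suc k) ∈ Laa a
Laa-column {a} {zero}  _   = Laa-row {a} z≤n
Laa-column {a} {suc j} k≤a = ∈-++⁺ʳ (map (λ i → (+ suc i , + 1)) (upTo (suc a)))
  (∈-map⁺ (λ j → (+ 1 , + (2 + j))) (∈-upTo⁺ k≤a))

∈-Laa⁻ : ∀ {a c} → c ∈ Laa a →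
  (Σ ℕ λ i → i ≤ a × c ≡ (+ suc i , + 1)) ⊎ (Σ ℕ λ k → k ≤ a × c ≡ (+ 1 , + suc k))
∈-Laa⁻ {a} c∈ with ∈-++⁻ (map (λ i → (+ suc i , + 1)) (upTo (suc a))) c∈
... | inj₁ c∈row with ∈-map⁻ (λ i → (+ suc i , + 1)) c∈row
...   | i , i∈ , refl = inj₁ (i , ≤-pred (∈-upTo⁻ i∈) , refl)
∈-Laa⁻ {a} c∈ | inj₂ c∈column with ∈-map⁻ (λ j → (+ 1 , + (2 + j))) c∈column
...   | j , j∈ , refl = inj₂ (suc j , ∈-upTo⁻ j∈ , refl)

placeCell : Placement → Cell → Cell
placeCell (place r c d) z = shiftCell c d (rotN (toℕ r) z)

∈-image⁺ : ∀ {P} p {c} → c ∈ P → placeCell p c ∈ image P p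
∈-image⁺ (place r dx dy) = ∈-map⁺ (placeCell (place r dx dy))

∈-image⁻ : ∀ {P} p {c} → c ∈ image P p → Σ Cell λ y → y ∈ P × c ≡ placeCell p y
∈-image⁻ (place r dx dy) = ∈-map⁻ (placeCell (place r dx dy))

-- The horizontal arm lies in `row`, over the columns left … left + a; the
-- vertical arm lies in `column`, over the rows bottom … bottom + a.
record Frame : Set where
  constructor mkFrame
  field
    row left column bottom : ℕ

open Frame

data LCell (a : ℕ) (F : Frame) : Cell → Set where
  horizontal : ∀ x → Segment (left F) a x → LCell a F (+ x , + row F)
  vertical   : ∀ y → Segment (bottom F) a y → LCell a F (+ column F , + y)

LDisjoint : ℕ → Frame → Frame → Set
LDisjoint a F G = ∀ {c} → LCell a F c → LCell a G c → ⊥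

record Connected (a : ℕ) (F : Frame) : Set where
  constructor mkConnected
  field
    column∈arm : Segment (left F) a (column F)
    row∈arm    : Segment (bottom F) a (row F)

record Fits (a n : ℕ) (F : Frame) : Set where
  constructor mkFits
  field
    1≤left    : 1 ≤ left F
    right≤n   : left F + a ≤ n
    1≤bottom  : 1 ≤ bottom F
    top≤n     : bottom F + a ≤ n
    connected : Connected a F

LCell-row∈ : ∀ {a F x y} → Connected a F → LCell a F (+ x , + y) → Segment (bottom F) a y
LCell-row∈ (mkConnected _ row∈arm) (horizontal _ _) = row∈arm
LCell-row∈ _                       (vertical _ y∈)  = y∈

LCell-column∈ : ∀ {a F x y} → Connected a F → LCell a F (+ x , + y) → Segment (left F) a x
LCell-column∈ _                          (horizontal _ x∈) = x∈
LCell-column∈ (mkConnected column∈arm _) (vertical _ _)    = column∈arm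

segment⇒inBoard : ∀ {lo a n x} → 1 ≤ lo → lo + a ≤ n → Segment lo a x → + 1 ℤ.≤ + x × + x ℤ.≤ + n
segment⇒inBoard 1≤lo hi≤n (lo≤x , x≤hi) = +≤+ (≤-trans 1≤lo lo≤x) , +≤+ (≤-trans x≤hi hi≤n)

LCell-inBoard : ∀ {a n F x y} → Fits a n F → LCell a F (+ x , + y) → InBoardCell n (+ x , + y)
LCell-inBoard (mkFits 1≤l r≤n 1≤b t≤n conn) c =
  segment⇒inBoard 1≤l r≤n (LCell-column∈ conn c) , segment⇒inBoard 1≤b t≤n (LCell-row∈ conn c)

record FrameOf (a : ℕ) (p : Placement) (F : Frame) : Set where
  field
    image⊆L : ∀ {c} → c ∈ image (Laa a) p → LCell a F c
    L⊆image : ∀ {c} → LCell a F c → c ∈ image (Laa a) p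

open FrameOf

record Placed (a n : ℕ) (p : Placement) : Set where
  constructor mkPlaced
  field
    frame   : Frame
    frameOf : FrameOf a p frame
    fits    : Fits a n frame

open Placed

placed⇒inBoard : ∀ {a n p} → Placed a n p → InBoard n (image (Laa a) p)
placed⇒inBoard {a} {n} Q = All.tabulate (λ c∈ → inBoard (image⊆L (frameOf Q) c∈))
  where
  inBoard : ∀ {c} → LCell a (frame Q) c → InBoardCell n c
  inBoard c@(horizontal _ _) = LCell-inBoard (fits Q) c
  inBoard c@(vertical _ _)   = LCell-inBoard (fits Q) c

disjoint-images : ∀ {a p q F G} → FrameOf a p F → FrameOf a q G →
  LDisjoint a F G → Disjoint (image (Laa a) p) (image (Laa a) q)
disjoint-images fp fq F#G _ c∈p c∈q = F#G (image⊆L fp c∈p) (image⊆L fq c∈q)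

inBoardCell⇒bounds : ∀ {n x y} → InBoardCell n (+ x , + y) → (1 ≤ x × x ≤ n) × (1 ≤ y × y ≤ n)
inBoardCell⇒bounds ((+≤+ 1≤x , +≤+ x≤n) , (+≤+ 1≤y , +≤+ y≤n)) = (1≤x , x≤n) , (1≤y , y≤n)

placed-from-image : ∀ {a n p F} → FrameOf a p F → Connected a F →
  InBoard n (image (Laa a) p) → Placed a n p
placed-from-image {a} {n} {F = F} fo conn B = mkPlaced F fo
  (mkFits (proj₁ (proj₁ (bounds (horizontal (left F) (≤-refl , m≤m+n _ a)))))
          (proj₂ (proj₁ (bounds (horizontal (left F + a) (m≤m+n _ a , ≤-refl)))))
          (proj₁ (proj₂ (bounds (vertical (bottom F) (≤-refl , m≤m+n _ a)))))
          (proj₂ (proj₂ (bounds (vertical (bottom F + a) (m≤m+n _ a , ≤-refl)))))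
          conn)
  where
  bounds : ∀ {x y} → LCell a F (+ x , + y) → (1 ≤ x × x ≤ n) × (1 ≤ y × y ≤ n)
  bounds c = inBoardCell⇒bounds (All.lookup B (L⊆image fo c))

module Rotation₀ (a M N : ℕ) where

  p : Placement
  p = place 0F (+ M) (+ N)

  F : Frame
  F = mkFrame (suc N) (suc M) (suc M) (suc N)

  connected : Connected a F
  connected = mkConnected (≤-refl , m≤m+n _ a) (≤-refl , m≤m+n _ a)

  isFrame : FrameOf a p F
  isFrame = record { image⊆L = image⊆L′ ; L⊆image = L⊆image′ }
    where
    image⊆L′ : ∀ {c} → c ∈ image (Laa a) p → LCell a F c
    image⊆L′ c∈ with ∈-image⁻ p c∈
    ... | _ , y∈ , refl with ∈-Laa⁻ {a} y∈
    ... | inj₁ (i , i≤a , refl) = horizontal (suc (i + M)) (shifted∈segment M i≤a)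
    ... | inj₂ (k , k≤a , refl) = vertical (suc (k + N)) (shifted∈segment N k≤a)

    L⊆image′ : ∀ {c} → LCell a F c → c ∈ image (Laa a) p
    L⊆image′ (horizontal x x∈) with segment⇒shifted M x∈
    ... | i , i≤a , refl = ∈-image⁺ p (Laa-row {a} i≤a)
    L⊆image′ (vertical y y∈) with segment⇒shifted N y∈
    ... | k , k≤a , refl = ∈-image⁺ p (Laa-column {a} k≤a)

  inBoard⇒placed : ∀ {n} → InBoard n (image (Laa a) p) → Placed a n p
  inBoard⇒placed = placed-from-image isFrame connected

module Rotation₁ (a P N : ℕ) where

  p : Placement
  p = place 1F (+ suc (a + P)) (+ N)

  F : Frame
  F = mkFrame (suc N) P (a + P) (suc N)

  connected : Connected a F
  connected = mkConnected (m≤n+m P a , ≤-reflexive (+-comm a P)) (≤-refl , m≤m+n _ a)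

  isFrame : FrameOf a p F
  isFrame = record { image⊆L = image⊆L′ ; L⊆image = L⊆image′ }
    where
    x≡ : ∀ {k} → k ≤ a → -[1+ k ] ℤ.+ + suc (a + P) ≡ + (a + P ∸ k)
    x≡ = -[1+k]+[1+a+P]≡a+P∸k a P

    image⊆L′ : ∀ {c} → c ∈ image (Laa a) p → LCell a F c
    image⊆L′ c∈ with ∈-image⁻ p c∈
    ... | _ , y∈ , refl with ∈-Laa⁻ {a} y∈
    ... | inj₁ (i , i≤a , refl) = subst (LCell a F) (cong (_, + suc (i + N)) (sym (x≡ z≤n)))
      (vertical (suc (i + N)) (shifted∈segment N i≤a))
    ... | inj₂ (k , k≤a , refl) = subst (LCell a F) (cong (_, + suc N) (sym (x≡ k≤a)))
      (horizontal (a + P ∸ k) (reflected∈segment P k≤a))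

    L⊆image′ : ∀ {c} → LCell a F c → c ∈ image (Laa a) p
    L⊆image′ (horizontal x x∈) with segment⇒reflected P x∈
    ... | k , k≤a , refl = subst (_∈ image (Laa a) p) (cong (_, + suc N) (x≡ k≤a))
      (∈-image⁺ p (Laa-column {a} k≤a))
    L⊆image′ (vertical y y∈) with segment⇒shifted N y∈
    ... | i , i≤a , refl = subst (_∈ image (Laa a) p) (cong (_, + suc (i + N)) (x≡ z≤n))
      (∈-image⁺ p (Laa-row {a} i≤a))

  inBoard⇒placed : ∀ {n} → InBoard n (image (Laa a) p) → Placed a n p
  inBoard⇒placed = placed-from-image isFrame connected

module Rotation₂ (a P R : ℕ) where

  p : Placement
  p = place 2F (+ suc (a + P)) (+ suc (a + R))

  F : Frame
  F = mkFrame (a + R) P (a + P) R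

  connected : Connected a F
  connected = mkConnected (m≤n+m P a , ≤-reflexive (+-comm a P)) (m≤n+m R a , ≤-reflexive (+-comm a R))

  isFrame : FrameOf a p F
  isFrame = record { image⊆L = image⊆L′ ; L⊆image = L⊆image′ }
    where
    x≡ : ∀ {k} → k ≤ a → -[1+ k ] ℤ.+ + suc (a + P) ≡ + (a + P ∸ k)
    x≡ = -[1+k]+[1+a+P]≡a+P∸k a P

    y≡ : ∀ {k} → k ≤ a → -[1+ k ] ℤ.+ + suc (a + R) ≡ + (a + R ∸ k)
    y≡ = -[1+k]+[1+a+P]≡a+P∸k a R

    image⊆L′ : ∀ {c} → c ∈ image (Laa a) p → LCell a F c
    image⊆L′ c∈ with ∈-image⁻ p c∈
    ... | _ , y∈ , refl with ∈-Laa⁻ {a} y∈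
    ... | inj₁ (i , i≤a , refl) = subst (LCell a F) (sym (cong₂ _,_ (x≡ i≤a) (y≡ z≤n)))
      (horizontal (a + P ∸ i) (reflected∈segment P i≤a))
    ... | inj₂ (k , k≤a , refl) = subst (LCell a F) (sym (cong₂ _,_ (x≡ z≤n) (y≡ k≤a)))
      (vertical (a + R ∸ k) (reflected∈segment R k≤a))

    L⊆image′ : ∀ {c} → LCell a F c → c ∈ image (Laa a) p
    L⊆image′ (horizontal x x∈) with segment⇒reflected P x∈
    ... | i , i≤a , refl = subst (_∈ image (Laa a) p) (cong₂ _,_ (x≡ i≤a) (y≡ z≤n))
      (∈-image⁺ p (Laa-row {a} i≤a))
    L⊆image′ (vertical y y∈) with segment⇒reflected R y∈
    ... | k , k≤a , refl = subst (_∈ image (Laa a) p) (cong₂ _,_ (x≡ z≤n) (y≡ k≤a))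
      (∈-image⁺ p (Laa-column {a} k≤a))

  inBoard⇒placed : ∀ {n} → InBoard n (image (Laa a) p) → Placed a n p
  inBoard⇒placed = placed-from-image isFrame connected

module Rotation₃ (a M R : ℕ) where

  p : Placement
  p = place 3F (+ M) (+ suc (a + R))

  F : Frame
  F = mkFrame (a + R) (suc M) (suc M) R

  connected : Connected a F
  connected = mkConnected (≤-refl , m≤m+n _ a) (m≤n+m R a , ≤-reflexive (+-comm a R))

  isFrame : FrameOf a p F
  isFrame = record { image⊆L = image⊆L′ ; L⊆image = L⊆image′ }
    where
    y≡ : ∀ {k} → k ≤ a → -[1+ k ] ℤ.+ + suc (a + R) ≡ + (a + R ∸ k)
    y≡ = -[1+k]+[1+a+P]≡a+P∸k a R

    image⊆L′ : ∀ {c} → c ∈ image (Laa a) p → LCell a F c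
    image⊆L′ c∈ with ∈-image⁻ p c∈
    ... | _ , y∈ , refl with ∈-Laa⁻ {a} y∈
    ... | inj₁ (i , i≤a , refl) = subst (LCell a F) (cong (+ suc M ,_) (sym (y≡ i≤a)))
      (vertical (a + R ∸ i) (reflected∈segment R i≤a))
    ... | inj₂ (k , k≤a , refl) = subst (LCell a F) (cong (+ suc (k + M) ,_) (sym (y≡ z≤n)))
      (horizontal (suc (k + M)) (shifted∈segment M k≤a))

    L⊆image′ : ∀ {c} → LCell a F c → c ∈ image (Laa a) p
    L⊆image′ (horizontal x x∈) with segment⇒shifted M x∈
    ... | k , k≤a , refl = subst (_∈ image (Laa a) p) (cong (+ suc (k + M) ,_) (y≡ z≤n))
      (∈-image⁺ p (Laa-column {a} k≤a))
    L⊆image′ (vertical y y∈) with segment⇒reflected R y∈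
    ... | i , i≤a , refl = subst (_∈ image (Laa a) p) (cong (+ suc M ,_) (y≡ i≤a))
      (∈-image⁺ p (Laa-row {a} i≤a))

  inBoard⇒placed : ∀ {n} → InBoard n (image (Laa a) p) → Placed a n p
  inBoard⇒placed = placed-from-image isFrame connected

inBoard⇒1≤coordinates : ∀ {n Q x y} → InBoard n Q → (x , y) ∈ Q → + 1 ℤ.≤ x × + 1 ℤ.≤ y
inBoard⇒1≤coordinates B c∈ with (1≤x , _) , (1≤y , _) ← All.lookup B c∈ = 1≤x , 1≤y

-- Each chosen cell has coordinates of the form + 1 + d or -[1+ a ] + d in the offsets d.
inBoard⇒placed : ∀ a n p → InBoard n (image (Laa a) p) → Placed a n p
inBoard⇒placed a n p@(place 0F dx dy) B
  with 1≤x , 1≤y ← inBoard⇒1≤coordinates B (∈-image⁺ p (Laa-row {a} z≤n))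
  with 1≤1+z⇒0≤z dx 1≤x | 1≤1+z⇒0≤z dy 1≤y
... | M , refl | N , refl = Rotation₀.inBoard⇒placed a M N B
inBoard⇒placed a n p@(place 1F dx dy) B
  with 1≤x , 1≤y ← inBoard⇒1≤coordinates B (∈-image⁺ p (Laa-column {a} ≤-refl))
  with 1≤-[1+a]+z⇒a<z a dx 1≤x | 1≤1+z⇒0≤z dy 1≤y
... | P , refl | N , refl = Rotation₁.inBoard⇒placed a P N B
inBoard⇒placed a n p@(place 2F dx dy) B
  with 1≤x , _ ← inBoard⇒1≤coordinates B (∈-image⁺ p (Laa-row {a} ≤-refl))
  with _ , 1≤y ← inBoard⇒1≤coordinates B (∈-image⁺ p (Laa-column {a} ≤-refl))
  with 1≤-[1+a]+z⇒a<z a dx 1≤x | 1≤-[1+a]+z⇒a<z a dy 1≤y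
... | P , refl | R , refl = Rotation₂.inBoard⇒placed a P R B
inBoard⇒placed a n p@(place 3F dx dy) B
  with 1≤x , _ ← inBoard⇒1≤coordinates B (∈-image⁺ p (Laa-row {a} z≤n))
  with _ , 1≤y ← inBoard⇒1≤coordinates B (∈-image⁺ p (Laa-row {a} ≤-refl))
  with 1≤1+z⇒0≤z dx 1≤x | 1≤-[1+a]+z⇒a<z a dy 1≤y
... | M , refl | R , refl = Rotation₃.inBoard⇒placed a M R B

meets-L₁-or-L₂ : ∀ {a F} → Fits a (suc (a + a)) F →
  Σ Cell λ c → LCell a F c ×
    (LCell a (mkFrame a 1 1 a) c ⊎ LCell a (mkFrame (suc a) (suc a) (suc a) (suc a)) c)
meets-L₁-or-L₂ {a} {F} (mkFits 1≤l r≤n 1≤b t≤n (mkConnected (l≤c , c≤r) (b≤w , w≤t)))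
  with suc a ≤? column F | bottom F ≤? a
... | yes a<c | _ = (+ column F , + suc a) ,
      vertical (suc a) (+-cancelʳ-≤ a _ _ t≤n , +-monoˡ-≤ a 1≤b) ,
      inj₂ (horizontal (column F) (a<c , ≤-trans c≤r r≤n))
... | no a≮c | yes b≤a = (+ column F , + a) ,
      vertical a (b≤a , m≤n+m a _) ,
      inj₁ (horizontal (column F) (≤-trans 1≤l l≤c , ≤-trans (≤-pred (≰⇒> a≮c)) (n≤1+n a)))
... | no _ | no b≰a = (+ suc a , + row F) ,
      horizontal (suc a) (+-cancelʳ-≤ a _ _ r≤n , +-monoˡ-≤ a 1≤l) ,
      inj₂ (vertical (row F) (≤-trans (≰⇒> b≰a) b≤w , ≤-trans w≤t t≤n))

lines-outside-box : ∀ {a F G} → Connected a F →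
  Outside (bottom F) a (row G) → Outside (left F) a (column G) → LDisjoint a G F
lines-outside-box conn row-out _ (horizontal _ _) c∈F = outside⇒∉segment row-out (LCell-row∈ conn c∈F)
lines-outside-box conn _ column-out (vertical _ _) c∈F = outside⇒∉segment column-out (LCell-column∈ conn c∈F)

data Edge : Set where
  first last : Edge

line : ℕ → Edge → ℕ
line a first = 1
line a last  = suc (a + a)

edge-outside : ∀ {a lo} → 1 ≤ a → Σ Edge λ e → Outside lo a (line a e)
edge-outside {a} {lo} 1≤a with 2 ≤? lo
... | yes 1<lo = first , inj₁ 1<lo
... | no  2≰lo = last , inj₂ (s≤s (+-monoˡ-≤ a (≤-trans (≤-pred (≰⇒> 2≰lo)) 1≤a)))

corner : ∀ a (r k : Edge) → Σ Placement λ q → Σ (Placed a (suc (a + a)) q) λ Q →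
  row (frame Q) ≡ line a r × column (frame Q) ≡ line a k
corner a first first = Rotation₀.p a 0 0 ,
  mkPlaced _ (Rotation₀.isFrame a 0 0)
    (mkFits (s≤s z≤n) (s≤s (m≤m+n a a)) (s≤s z≤n) (s≤s (m≤m+n a a)) (Rotation₀.connected a 0 0)) ,
  refl , refl
corner a first last = Rotation₁.p a (suc a) 0 ,
  mkPlaced _ (Rotation₁.isFrame a (suc a) 0)
    (mkFits (s≤s z≤n) ≤-refl (s≤s z≤n) (s≤s (m≤m+n a a)) (Rotation₁.connected a (suc a) 0)) ,
  refl , +-suc a a
corner a last last = Rotation₂.p a (suc a) (suc a) ,
  mkPlaced _ (Rotation₂.isFrame a (suc a) (suc a))
    (mkFits (s≤s z≤n) ≤-refl (s≤s z≤n) ≤-refl (Rotation₂.connected a (suc a) (suc a))) ,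
  +-suc a a , +-suc a a
corner a last first = Rotation₃.p a 0 (suc a) ,
  mkPlaced _ (Rotation₃.isFrame a 0 (suc a))
    (mkFits (s≤s z≤n) (s≤s (m≤m+n a a)) (s≤s z≤n) ≤-refl (Rotation₃.connected a 0 (suc a))) ,
  +-suc a a , refl

module Packing (b : ℕ) where

  a n : ℕ
  a = suc b
  n = suc (a + a)

  L₁ L₂ : Placement
  L₁ = Rotation₀.p a 0 b
  L₂ = Rotation₀.p a a a

  placed-L₁ : Placed a n L₁
  placed-L₁ = mkPlaced _ (Rotation₀.isFrame a 0 b)
    (mkFits (s≤s z≤n) (s≤s (m≤m+n a a)) (s≤s z≤n) (n≤1+n _) (Rotation₀.connected a 0 b))

  placed-L₂ : Placed a n L₂
  placed-L₂ = mkPlaced _ (Rotation₀.isFrame a a a)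
    (mkFits (s≤s z≤n) ≤-refl (s≤s z≤n) ≤-refl (Rotation₀.connected a a a))

  L₁-L₂-disjoint : LDisjoint a (Rotation₀.F a 0 b) (Rotation₀.F a a a)
  L₁-L₂-disjoint (horizontal _ _) (vertical _ (a<a , _))      = n≮n a a<a
  L₁-L₂-disjoint (vertical _ _)   (horizontal _ (s≤s () , _))

  L : Polyomino
  L = Laa a

  L₁L₂-valid : Valid n L (L₁ ∷ L₂ ∷ [])
  L₁L₂-valid = (placed⇒inBoard placed-L₁ ∷ placed⇒inBoard placed-L₂ ∷ []) ,
    (disjoint-images (frameOf placed-L₁) (frameOf placed-L₂) L₁-L₂-disjoint ∷ []) ∷ [] ∷ []

  L₁L₂-maximal : ∀ q → ¬ Valid n L (q ∷ L₁ ∷ L₂ ∷ [])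
  L₁L₂-maximal q ((q-inBoard ∷ _) , (q#L₁ ∷ q#L₂ ∷ []) ∷ _)
    with Q ← inBoard⇒placed a n q q-inBoard
    with meets-L₁-or-L₂ (fits Q)
  ... | c , c∈Q , inj₁ c∈L₁ = q#L₁ c (L⊆image (frameOf Q) c∈Q) (L⊆image (frameOf placed-L₁) c∈L₁)
  ... | c , c∈Q , inj₂ c∈L₂ = q#L₂ c (L⊆image (frameOf Q) c∈Q) (L⊆image (frameOf placed-L₂) c∈L₂)

  single-copy-extends : ∀ p → InBoard n (image L p) → Σ Placement λ q → Valid n L (q ∷ p ∷ [])
  single-copy-extends p p-inBoard
    with mkPlaced F p-frame (mkFits _ _ _ _ conn) ← inBoard⇒placed a n p p-inBoard
    with r , row-out ← edge-outside {a} {bottom F} (s≤s z≤n)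
    with k , column-out ← edge-outside {a} {left F} (s≤s z≤n)
    with q , Q , row≡ , column≡ ← corner a r k =
    q , (placed⇒inBoard Q ∷ p-inBoard ∷ []) ,
    (disjoint-images (frameOf Q) p-frame
      (lines-outside-box conn (subst (Outside _ a) (sym row≡) row-out)
                              (subst (Outside _ a) (sym column≡) column-out))
      ∷ []) ∷ [] ∷ []

  at-least-two : ∀ ps → FreePacking n L ps → 2 ≤ length ps
  at-least-two []      (_ , maximal) = ⊥-elim (maximal L₁ ((placed⇒inBoard placed-L₁ ∷ []) , [] ∷ []))
  at-least-two (p ∷ []) (((p-inBoard ∷ []) , _) , maximal)
    with q , valid ← single-copy-extends p p-inBoard = ⊥-elim (maximal q valid)
  at-least-two (_ ∷ _ ∷ _) _ = s≤s (s≤s z≤n)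

  cp-free-Laa : CpFreeIs n L 2
  cp-free-Laa = ((L₁ ∷ L₂ ∷ []) , (L₁L₂-valid , L₁L₂-maximal) , refl) , at-least-two

theorem3p10 : (a : ℕ) → 1 ≤ a → CpFreeIs (2 * a + 1) (Laa a) 2
theorem3p10 a@(suc b) _ = subst (λ n → CpFreeIs n (Laa a) 2) board-size (Packing.cp-free-Laa b)
  where
  board-size : suc (a + a) ≡ 2 * a + 1
  board-size = trans (cong (λ t → suc (a + t)) (sym (+-identityʳ a))) (+-comm 1 (2 * a))
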